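{- Let $M$ be a unicyclic partial multiplication matrix, let $\pi^\#$ be a gridded $M$-coil with points $v_1,\dots,v_n$, and let $\sigma^\#$ be a gridded $M$-coil with points $u_1,\dots,u_m$, where $m<n$ (points listed in the orderings from the definition of gridded coil). Let $L=\{\bullet,\circ\}$ be a two-element antichain, and label $\pi^\#$ by $\lambda(v_i)=\circ$ if $i\in\{1,n\}$ and $\lambda(v_i)=\bullet$ if $1<i<n$, and $\sigma^\#$ by $\mu(u_i)=\circ$ if $i\in\{1,m\}$ and $\mu(u_i)=\bullet$ if $1<i<m$. Then there is no labelled embedding of $(\sigma^\#,\mu)$ into $(\pi^\#,\lambda)$, i.e. no gridded embedding of $\sigma^\#$ into $\pi^\#$ sending each point to a point with the same label.
   Context: A gridding matrix is a matrix with entries in $\{0,1,-1\}$ ($m$ columns, $n$ rows; $M_{ij}$ in column $i$ from the left, row $j$ from the bottom). An $M$-gridding of a permutation is a division of its plot by vertical and horizontal lines into cells, each point interior to a cell, with cell $ij$ empty if $M_{ij}=0$, increasing if $M_{ij}=1$, decreasing if $M_{ij}=-1$; an $M$-gridded permutation is a permutation with a fixed $M$-gridding. A gridded embedding of $\sigma^\#$ into $\pi^\#$ is an embedding of $\sigma$ into $\pi$ sending points in cell $ij$ to points in cell $ij$. The row-column graph $G_M$ is the bipartite graph on columns and rows with edge $ij'$ iff $M_{ij}\neq0$ (cell $ij$ corresponds to edge $ij'$); $M$ is unicyclic if $G_M$ contains exactly one cycle, of length $\ell$ say. A partial multiplication matrix is a gridding matrix with fixed $c_i,r_j\in\{\pm1\}$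 such that $M_{ij}=c_ir_j$ whenever $M_{ij}\ne0$; column $i$ is oriented left-to-right if $c_i=1$ and right-to-left otherwise, row $j$ bottom-to-top if $r_j=1$ and top-to-bottom otherwise. The orientation digraph of an $M$-gridded permutation has an arc $x\to y$ between points sharing a column (resp. row) when $x$ precedes $y$ in its orientation. A gridded $M$-coil is an $M$-gridded permutation with $n>\ell$ points, an ordering $v_1,\dots,v_n$ of its points and a labelling $1,\dots,\ell$ of the cells corresponding to the edges of the cycle, with (C1) $v_i$ in cell $i\bmod\ell$ (residues in $\{1,\dots,\ell\}$); (C2) $v_{i-1}\to v_i$ for $1<i\le n$; (C3) $v_i\to v_{i-\ell-1}$ for $\ell+1<i\le n$; (C4) $v_{\ell+1}\to v_1$. -}

module Defs where

open import Data.Nat as ℕ using (ℕ; zero; suc; _+_; _*_)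
open import Data.Fin using (Fin; toℕ; _<_; _≤_)
open import Data.Integer as ℤ using (ℤ; +_; -[1+_])
open import Data.Sign as Sign using (Sign)
open import Data.Product using (Σ; ∃; ∃-syntax; _×_; _,_)
open import Data.Sum using (_⊎_; inj₁; inj₂)
open import Data.Empty using (⊥)
open import Relation.Nullary using (¬_)
open import Relation.Binary.PropositionalEquality using (_≡_; _≢_)
open import Function.Definitions using (Injective)

-- Conventions: columns indexed by Fin c (left to right), rows by Fin r
-- (bottom to top); a matrix is M : Fin c → Fin r → ℤ, M i j = M_{ij}.
-- Everything is 0-indexed (paper's index k corresponds to k-1 here).

sgn : Sign → ℤ
sgn Sign.+ = + 1
sgn Sign.- = -[1+ 0 ]

record PMM (c r : ℕ) : Set where
  field
    M       : Fin c → Fin r → ℤ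
    cs      : Fin c → Sign
    rs      : Fin r → Sign
    entries : ∀ i j → M i j ≡ + 0 ⊎ M i j ≡ sgn (cs i Sign.* rs j)

Vertex : ℕ → ℕ → Set
Vertex c r = Fin c ⊎ Fin r

Adj : ∀ {c r} → (Fin c → Fin r → ℤ) → Vertex c r → Vertex c r → Set
Adj M (inj₁ i) (inj₂ j) = M i j ≢ + 0
Adj M (inj₂ j) (inj₁ i) = M i j ≢ + 0
Adj M (inj₁ _) (inj₁ _) = ⊥
Adj M (inj₂ _) (inj₂ _) = ⊥

CycSucc : ∀ {k} → Fin k → Fin k → Set
CycSucc {k} t s = (toℕ s ≡ suc (toℕ t)) ⊎ (toℕ s ≡ 0 × suc (toℕ t) ≡ k)

record Cycle {c r} (M : Fin c → Fin r → ℤ) : Set where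
  field
    len   : ℕ
    len≥3 : 3 ℕ.≤ len
    w     : Fin len → Vertex c r
    w-inj : Injective _≡_ _≡_ w
    adj   : ∀ t s → CycSucc t s → Adj M (w t) (w s)

EdgeIn : ∀ {c r} {M : Fin c → Fin r → ℤ} → Cycle M → Fin c → Fin r → Set
EdgeIn C i j = ∃[ t ] ∃[ s ] (CycSucc t s ×
  ((w t ≡ inj₁ i × w s ≡ inj₂ j) ⊎ (w t ≡ inj₂ j × w s ≡ inj₁ i)))
  where open Cycle C

-- G_M contains exactly one cycle (cycles considered as subgraphs, i.e.
-- determined by their edge sets).
Unicyclic : ∀ {c r} → (Fin c → Fin r → ℤ) → Set
Unicyclic M = Σ (Cycle M) λ C → ∀ (D : Cycle M) → ∀ i j →
  (EdgeIn C i j → EdgeIn D i j) × (EdgeIn D i j → EdgeIn C i j)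

-- Points are Fin n, point p has
-- position (x-coordinate) p and value val p.  The gridding lines are
-- encoded by assigning to each point its column and row, monotonically
-- in position resp. value.

record GP {c r} (M : Fin c → Fin r → ℤ) (n : ℕ) : Set where
  field
    val      : Fin n → Fin n
    val-inj  : Injective _≡_ _≡_ val
    col      : Fin n → Fin c
    row      : Fin n → Fin r
    col-mono : ∀ p q → p < q → col p ≤ col q
    row-mono : ∀ p q → val p < val q → row p ≤ row q
    nonempty : ∀ p → M (col p) (row p) ≢ + 0
    incr     : ∀ p q → M (col p) (row p) ≡ + 1 → col p ≡ col q → row p ≡ row q →
               p < q → val p < val q
    decr     : ∀ p q → M (col p) (row p) ≡ -[1+ 0 ] → col p ≡ col q → row p ≡ row q →
               p < q → val q < val p

record GriddedEmb {c r} {M : Fin c → Fin r → ℤ} {m n : ℕ}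
                  (σ : GP M m) (π : GP M n) : Set where
  private
    module σ = GP σ
    module π = GP π
  field
    f      : Fin m → Fin n
    f-pos  : ∀ a b → a < b → f a < f b
    f-val  : ∀ a b → σ.val a < σ.val b → π.val (f a) < π.val (f b)
    f-col  : ∀ a → π.col (f a) ≡ σ.col a
    f-row  : ∀ a → π.row (f a) ≡ σ.row a

Precedes : ∀ {n} → Sign → Fin n → Fin n → Set
Precedes Sign.+ a b = a < b
Precedes Sign.- a b = b < a

Arc : ∀ {c r n} (P : PMM c r) → GP (PMM.M P) n → Fin n → Fin n → Set
Arc P π x y =
  (col x ≡ col y × Precedes (PMM.cs P (col x)) x y) ⊎
  (row x ≡ row y × Precedes (PMM.rs P (row x)) (val x) (val y))
  where open GP π

-- Gridded M-coil structure on an M-gridded permutation π# of size n: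
-- the cycle of G_M, a labelling lab : Fin ℓ → cells (bijective onto the
-- cells of the cycle) and an ordering v_0,…,v_{n-1} of the points.

record Coil {c r n} (P : PMM c r) (π : GP (PMM.M P) n) : Set where
  field
    cyc     : Cycle (PMM.M P)
  ℓ : ℕ
  ℓ = Cycle.len cyc
  field
    lab     : Fin ℓ → Fin c × Fin r
    lab-inj : Injective _≡_ _≡_ lab
    lab-cyc : ∀ i j → (EdgeIn cyc i j → ∃[ t ] lab t ≡ (i , j)) ×
                      (∃[ t ] lab t ≡ (i , j) → EdgeIn cyc i j)
    ℓ<n     : ℓ ℕ.< n
    v       : Fin n → Fin n
    v-inj   : Injective _≡_ _≡_ v
    C1 : ∀ a (t : Fin ℓ) q → toℕ a ≡ q * ℓ + toℕ t →
         (GP.col π (v a) , GP.row π (v a)) ≡ lab t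
    C2 : ∀ a b → toℕ b ≡ suc (toℕ a) → Arc P π (v a) (v b)
    C3 : ∀ a b → toℕ a ≡ toℕ b + suc ℓ → Arc P π (v a) (v b)
    C4 : ∀ a b → toℕ a ≡ ℓ → toℕ b ≡ 0 → Arc P π (v a) (v b)

data Label : Set where
  ● ○ : Label

endLabel : (n : ℕ) → Fin n → Label
endLabel n a with toℕ a ℕ.≟ 0 | suc (toℕ a) ℕ.≟ n
... | Relation.Nullary.yes _ | _ = ○
... | Relation.Nullary.no _ | Relation.Nullary.yes _ = ○
... | Relation.Nullary.no _ | Relation.Nullary.no _ = ●

-- Labelled embedding of (σ#, μ) into (π#, λ): a gridded embedding such
-- that the image of each point has the same label (L is an antichain).
record LabelledEmb {c r m n} (P : PMM c r)
                   (σ : GP (PMM.M P) m) (Kσ : Coil P σ)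
                   (π : GP (PMM.M P) n) (Kπ : Coil P π) : Set where
  field
    emb   : GriddedEmb σ π
    label : ∀ (a : Fin m) (b : Fin n) →
            GriddedEmb.f emb (Coil.v Kσ a) ≡ Coil.v Kπ b →
            endLabel m a ≡ endLabel n b

{-# OPTIONS --safe #-}
module Submission where

-- An arc v_i → v_j of the orientation digraph between points of a coil forces j ≤ i + 1 (indices
-- from 0).  Otherwise the cells of v_i and v_j share a line, so, the vertices of a cycle having
-- degree two, they are equal or adjacent along the cycle; chains of (C2)–(C4) arcs through points
-- of a common cell then yield the reverse arc v_j → v_i, and the orientation digraph has no
-- 2-cycles.  A gridded embedding preserves arcs, so it induces an injective map g on coil indices
-- with g(i + 1) ≤ g(i) + 1.  The ○ labels force g(0) and g(m - 1) into {0, n - 1}.  If g(0) = 0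
-- then g(m - 1) ≤ m - 1 < n - 1, so g(m - 1) = g(0) although m > ℓ ≥ 3.  If g(0) = n - 1 then the
-- arc u_ℓ → u_0 of (C4) forces g(ℓ) = n - 2, yet u_ℓ and u_0 share a cell while the consecutive
-- points v_{n-2} and v_{n-1} do not.

open import Defs
open import Data.Nat using (_<_)
open import Relation.Nullary using (¬_)

open import Data.Nat as ℕ using (ℕ; zero; suc; pred; _+_; _*_; _≤_; z≤n; s≤s; NonZero)
import Data.Nat.Properties as ℕP
open import Data.Nat.DivMod
  using (_%_; _/_; _mod_; m≡m%n+[m/n]*n; /-monoˡ-≤; [m+n]%n≡m%n; m%n%n≡m%n; %-distribˡ-+; m%n<n)
open import Data.Fin as F using (Fin; toℕ; fromℕ<)
open import Data.Integer using (ℤ)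
import Data.Fin.Properties as FP
open import Data.Sign as Sign using (Sign)
open import Data.Product using (∃-syntax; _×_; _,_; proj₁; proj₂; uncurry)
open import Data.Product.Properties using (,-injectiveˡ; ,-injectiveʳ)
open import Data.Sum using (_⊎_; inj₁; inj₂; [_,_]′)
open import Data.Sum.Properties using (inj₁-injective; inj₂-injective)
open import Data.Empty using (⊥; ⊥-elim)
open import Function using (_∘_; id)
open import Function.Definitions using (Injective)
open import Relation.Nullary using (yes; no)
open import Relation.Binary.Definitions using (tri<; tri≈; tri>)
open import Relation.Binary.Structures using (IsStrictTotalOrder)
import Relation.Binary.Construct.Flip.EqAndOrd as Flip
open import Relation.Binary.PropositionalEquality

m%n≡o%n⇒o≡m+k*n : ∀ {m o} n .{{_ : NonZero n}} → m ≤ o → m % n ≡ o % n →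
                 ∃[ k ] o ≡ m + k * n
m%n≡o%n⇒o≡m+k*n {m} {o} n m≤o m%n≡o%n = k , (begin
  o                          ≡⟨ m≡m%n+[m/n]*n o n ⟩
  o % n + o / n * n          ≡⟨ cong₂ _+_ (sym m%n≡o%n) (cong (_* n) (sym (ℕP.m+[n∸m]≡n m/n≤o/n))) ⟩
  m % n + (m / n + k) * n    ≡⟨ cong (m % n +_) (ℕP.*-distribʳ-+ n (m / n) k) ⟩
  m % n + (m / n * n + k * n) ≡⟨ sym (ℕP.+-assoc (m % n) _ _) ⟩
  m % n + m / n * n + k * n  ≡⟨ cong (_+ k * n) (sym (m≡m%n+[m/n]*n m n)) ⟩
  m + k * n                  ∎)
  where
  open ≡-Reasoning
  m/n≤o/n : m / n ≤ o / n
  m/n≤o/n = /-monoˡ-≤ n m≤o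
  k : ℕ
  k = o / n ℕ.∸ m / n

m%n≢[m+d]%n : ∀ m {d} n .{{_ : NonZero n}} → 0 < d → d < n → m % n ≢ (m + d) % n
m%n≢[m+d]%n m {d} n 0<d d<n eq with m%n≡o%n⇒o≡m+k*n n (ℕP.m≤m+n m d) eq
... | zero , m+d≡m+0 = ℕP.<-irrefl (sym (ℕP.+-cancelˡ-≡ m d 0 m+d≡m+0)) 0<d
... | suc k , m+d≡m+n+kn = ℕP.<⇒≱ d<n (begin
  n          ≤⟨ ℕP.m≤m+n n (k * n) ⟩
  n + k * n  ≡⟨ sym (ℕP.+-cancelˡ-≡ m d _ m+d≡m+n+kn) ⟩
  d          ∎)
  where open ℕP.≤-Reasoning

[1+m]%n≡[1+o]%n : ∀ {m o} n .{{_ : NonZero n}} → m % n ≡ o % n → suc m % n ≡ suc o % n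
[1+m]%n≡[1+o]%n {m} {o} n eq = begin
  suc m % n                ≡⟨ %-distribˡ-+ 1 m n ⟩
  (1 % n + m % n) % n      ≡⟨ cong (λ x → (1 % n + x) % n) eq ⟩
  (1 % n + o % n) % n      ≡⟨ %-distribˡ-+ 1 o n ⟨
  suc o % n                ∎
  where open ≡-Reasoning

[1+m+pred[n]]%n≡m%n : ∀ m n .{{_ : NonZero n}} → suc (m + pred n) % n ≡ m % n
[1+m+pred[n]]%n≡m%n m n = begin
  suc (m + pred n) % n  ≡⟨ cong (_% n) (ℕP.+-suc m (pred n)) ⟨
  (m + suc (pred n)) % n ≡⟨ cong (λ x → (m + x) % n) (ℕP.suc-pred n) ⟩
  (m + n) % n           ≡⟨ [m+n]%n≡m%n m n ⟩
  m % n                 ∎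
  where open ≡-Reasoning

-- m + pred n represents m - 1 modulo n.
neighbour-residues-distinct : ∀ {n} .{{_ : NonZero n}} → 3 ≤ n → ∀ m →
  m % n ≢ suc m % n × m % n ≢ (m + pred n) % n × suc m % n ≢ (m + pred n) % n
neighbour-residues-distinct {suc (suc (suc k))} (s≤s (s≤s (s≤s _))) m =
  (λ eq → m%n≢[m+d]%n m {1} n (s≤s z≤n) (s≤s (s≤s z≤n)) (trans eq (cong (_% n) (ℕP.+-comm 1 m)))) ,
  m%n≢[m+d]%n m n (s≤s z≤n) (ℕP.n<1+n _) ,
  (λ eq → m%n≢[m+d]%n (suc m) {suc k} n (s≤s z≤n) (ℕP.n≤1+n _)
            (trans eq (cong (_% n) (ℕP.+-suc m (suc k)))))
  where
  n : ℕ
  n = suc (suc (suc k))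

Precedes-isStrictTotalOrder : ∀ {n} s → IsStrictTotalOrder _≡_ (Precedes {n} s)
Precedes-isStrictTotalOrder Sign.+ = FP.<-isStrictTotalOrder
Precedes-isStrictTotalOrder Sign.- = Flip.isStrictTotalOrder FP.<-isStrictTotalOrder

module Precedesₛ {n} (s : Sign) = IsStrictTotalOrder (Precedes-isStrictTotalOrder {n} s)

Precedes-mono : ∀ {A : Set} {m n} (h : A → Fin m) (k : A → Fin n) →
                (∀ a b → h a F.< h b → k a F.< k b) →
                ∀ s {a b} → Precedes s (h a) (h b) → Precedes s (k a) (k b)
Precedes-mono h k mono Sign.+ {a} {b} = mono a b
Precedes-mono h k mono Sign.- {a} {b} = mono b a

SharesLine : ∀ {c r} → Fin c × Fin r → Fin c × Fin r → Set
SharesLine (i , j) (i′ , j′) = i ≡ i′ ⊎ j ≡ j′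

SharesLine-sym : ∀ {c r} {x y : Fin c × Fin r} → SharesLine x y → SharesLine y x
SharesLine-sym (inj₁ eq) = inj₁ (sym eq)
SharesLine-sym (inj₂ eq) = inj₂ (sym eq)

module Orientation {c r n} (P : PMM c r) (π : GP (PMM.M P) n) where
  open PMM P
  open GP π

  cell : Fin n → Fin c × Fin r
  cell x = col x , row x

  ColArc RowArc : Fin n → Fin n → Set
  ColArc x y = col x ≡ col y × Precedes (cs (col x)) x y
  RowArc x y = row x ≡ row y × Precedes (rs (row x)) (val x) (val y)

  ColArc-trans : ∀ {x y z} → ColArc x y → ColArc y z → ColArc x z
  ColArc-trans {x} {y} {z} (cx≡cy , x<y) (cy≡cz , y<z) =
    trans cx≡cy cy≡cz ,
    Precedesₛ.trans (cs (col x)) x<y (subst (λ i → Precedes (cs i) y z) (sym cx≡cy) y<z)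

  RowArc-trans : ∀ {x y z} → RowArc x y → RowArc y z → RowArc x z
  RowArc-trans {x} {y} {z} (rx≡ry , x<y) (ry≡rz , y<z) =
    trans rx≡ry ry≡rz ,
    Precedesₛ.trans (rs (row x)) x<y (subst (λ j → Precedes (rs j) (val y) (val z)) (sym rx≡ry) y<z)

  ColArc-asym : ∀ {x y} → ColArc x y → ¬ ColArc y x
  ColArc-asym {x} {y} (cx≡cy , x<y) (_ , y<x) =
    Precedesₛ.asym (cs (col x)) x<y (subst (λ i → Precedes (cs i) y x) (sym cx≡cy) y<x)

  RowArc-asym : ∀ {x y} → RowArc x y → ¬ RowArc y x
  RowArc-asym {x} {y} (rx≡ry , x<y) (_ , y<x) =
    Precedesₛ.asym (rs (row x)) x<y (subst (λ j → Precedes (rs j) (val y) (val x)) (sym rx≡ry) y<x)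

  -- Within cell ij the points form a monotone sequence of slope M i j = cs i * rs j.
  ColArc⇒RowArc : ∀ {x y} → cell x ≡ cell y → ColArc x y → RowArc x y
  ColArc⇒RowArc {x} {y} x≈y (cx≡cy , x<y)
    with entries (col x) (row x) | nonempty x | ,-injectiveʳ x≈y | cong (uncurry M) (sym x≈y)
  ... | inj₁ M≡0  | M≢0 | _     | _     = ⊥-elim (M≢0 M≡0)
  ... | inj₂ M≡cr | _   | rx≡ry | My≡Mx with cs (col x) | rs (row x)
  ... | Sign.+ | Sign.+ = rx≡ry , incr x y M≡cr cx≡cy rx≡ry x<y
  ... | Sign.+ | Sign.- = rx≡ry , decr x y M≡cr cx≡cy rx≡ry x<y
  ... | Sign.- | Sign.+ = rx≡ry , decr y x (trans My≡Mx M≡cr) (sym cx≡cy) (sym rx≡ry) x<y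
  ... | Sign.- | Sign.- = rx≡ry , incr y x (trans My≡Mx M≡cr) (sym cx≡cy) (sym rx≡ry) x<y

  RowArc⇒ColArc : ∀ {x y} → cell x ≡ cell y → RowArc x y → ColArc x y
  RowArc⇒ColArc {x} {y} x≈y x→y with Precedesₛ.compare (cs (col x)) x y
  ... | tri< x<y _ _ = ,-injectiveˡ x≈y , x<y
  ... | tri≈ _ refl _ = ⊥-elim (RowArc-asym x→y x→y)
  ... | tri> _ _ y<x =
    ⊥-elim (RowArc-asym x→y (ColArc⇒RowArc (sym x≈y) y→x))
    where
    cx≡cy : col x ≡ col y
    cx≡cy = ,-injectiveˡ x≈y
    y→x : ColArc y x
    y→x = sym cx≡cy , subst (λ i → Precedes (cs i) y x) cx≡cy y<x

  _≺_ _≼_ : Fin n → Fin n → Set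
  x ≺ y = cell x ≡ cell y × ColArc x y
  x ≼ y = x ≡ y ⊎ x ≺ y

  ≺⇒Arc : ∀ {x y} → x ≺ y → Arc P π x y
  ≺⇒Arc = inj₁ ∘ proj₂

  Arc⇒≺ : ∀ {x y} → cell x ≡ cell y → Arc P π x y → x ≺ y
  Arc⇒≺ x≈y (inj₁ x→y) = x≈y , x→y
  Arc⇒≺ x≈y (inj₂ x→y) = x≈y , RowArc⇒ColArc x≈y x→y

  ≺-≼-trans : ∀ {x y z} → x ≺ y → y ≼ z → x ≺ z
  ≺-≼-trans x≺y (inj₁ refl) = x≺y
  ≺-≼-trans (x≈y , x→y) (inj₂ (y≈z , y→z)) = trans x≈y y≈z , ColArc-trans x→y y→z

  Arc-≼-trans : ∀ {x y z} → Arc P π x y → y ≼ z → Arc P π x z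
  Arc-≼-trans x→y (inj₁ refl) = x→y
  Arc-≼-trans (inj₁ x→y) (inj₂ (_ , y→z)) = inj₁ (ColArc-trans x→y y→z)
  Arc-≼-trans (inj₂ x→y) (inj₂ (y≈z , y→z)) =
    inj₂ (RowArc-trans x→y (ColArc⇒RowArc y≈z y→z))

  ≼-Arc-trans : ∀ {x y z} → x ≼ y → Arc P π y z → Arc P π x z
  ≼-Arc-trans (inj₁ refl) y→z = y→z
  ≼-Arc-trans (inj₂ (_ , x→y)) (inj₁ y→z) = inj₁ (ColArc-trans x→y y→z)
  ≼-Arc-trans (inj₂ (x≈y , x→y)) (inj₂ y→z) =
    inj₂ (RowArc-trans (ColArc⇒RowArc x≈y x→y) y→z)

  -- A column arc followed by a row arc (or vice versa) would put y in the cell of x and z.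
  Arc-Arc⇒≺ : ∀ {x y z} → Arc P π x y → Arc P π y z →
              cell x ≡ cell z → cell x ≢ cell y → x ≺ z
  Arc-Arc⇒≺ (inj₁ x→y) (inj₁ y→z) x≈z _ = x≈z , ColArc-trans x→y y→z
  Arc-Arc⇒≺ (inj₂ x→y) (inj₂ y→z) x≈z _ = Arc⇒≺ x≈z (inj₂ (RowArc-trans x→y y→z))
  Arc-Arc⇒≺ (inj₁ x→y) (inj₂ y→z) x≈z x≉y =
    ⊥-elim (x≉y (cong₂ _,_ (proj₁ x→y) (trans (,-injectiveʳ x≈z) (sym (proj₁ y→z)))))
  Arc-Arc⇒≺ (inj₂ x→y) (inj₁ y→z) x≈z x≉y =
    ⊥-elim (x≉y (cong₂ _,_ (trans (,-injectiveˡ x≈z) (sym (proj₁ y→z))) (proj₁ x→y)))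

  Arc-asym : ∀ {x y} → Arc P π x y → ¬ Arc P π y x
  Arc-asym (inj₁ x→y) (inj₁ y→x) = ColArc-asym x→y y→x
  Arc-asym (inj₂ x→y) (inj₂ y→x) = RowArc-asym x→y y→x
  Arc-asym (inj₁ x→y) (inj₂ y→x) =
    RowArc-asym (ColArc⇒RowArc (cong₂ _,_ (proj₁ x→y) (sym (proj₁ y→x))) x→y) y→x
  Arc-asym (inj₂ x→y) (inj₁ y→x) =
    RowArc-asym x→y (ColArc⇒RowArc (cong₂ _,_ (proj₁ y→x) (sym (proj₁ x→y))) y→x)

  Arc⇒SharesLine : ∀ {x y} → Arc P π x y → SharesLine (cell x) (cell y)
  Arc⇒SharesLine (inj₁ x→y) = inj₁ (proj₁ x→y)
  Arc⇒SharesLine (inj₂ x→y) = inj₂ (proj₁ x→y)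

CycSucc-functional : ∀ {k} {t s s′ : Fin k} → CycSucc t s → CycSucc t s′ → s ≡ s′
CycSucc-functional (inj₁ s≡1+t) (inj₁ s′≡1+t) = FP.toℕ-injective (trans s≡1+t (sym s′≡1+t))
CycSucc-functional {s = s} (inj₁ s≡1+t) (inj₂ (_ , 1+t≡k)) =
  ⊥-elim (ℕP.<-irrefl (trans s≡1+t 1+t≡k) (FP.toℕ<n s))
CycSucc-functional {s′ = s′} (inj₂ (_ , 1+t≡k)) (inj₁ s′≡1+t) =
  ⊥-elim (ℕP.<-irrefl (trans s′≡1+t 1+t≡k) (FP.toℕ<n s′))
CycSucc-functional (inj₂ (s≡0 , _)) (inj₂ (s′≡0 , _)) = FP.toℕ-injective (trans s≡0 (sym s′≡0))

CycSucc-injective : ∀ {k} {t t′ s : Fin k} → CycSucc t s → CycSucc t′ s → t ≡ t′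
CycSucc-injective (inj₁ s≡1+t) (inj₁ s≡1+t′) =
  FP.toℕ-injective (ℕP.suc-injective (trans (sym s≡1+t) s≡1+t′))
CycSucc-injective (inj₁ s≡1+t) (inj₂ (s≡0 , _)) with trans (sym s≡1+t) s≡0
... | ()
CycSucc-injective (inj₂ (s≡0 , _)) (inj₁ s≡1+t′) with trans (sym s≡1+t′) s≡0
... | ()
CycSucc-injective (inj₂ (_ , 1+t≡k)) (inj₂ (_ , 1+t′≡k)) =
  FP.toℕ-injective (ℕP.suc-injective (trans 1+t≡k (sym 1+t′≡k)))

module CycleDegree {c r} {M : Fin c → Fin r → ℤ} (C : Cycle M) where
  open Cycle C

  CycleEdge : Vertex c r → Vertex c r → Set
  CycleEdge x y = ∃[ t ] ∃[ s ] (CycSucc t s × ((w t ≡ x × w s ≡ y) ⊎ (w t ≡ y × w s ≡ x)))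

  CycleEdge-sym : ∀ {x y} → CycleEdge x y → CycleEdge y x
  CycleEdge-sym (t , s , t→s , inj₁ ends) = t , s , t→s , inj₂ ends
  CycleEdge-sym (t , s , t→s , inj₂ ends) = t , s , t→s , inj₁ ends

  private
    Next : Vertex c r → Vertex c r → Set
    Next x y = ∃[ t ] ∃[ s ] (CycSucc t s × w t ≡ x × w s ≡ y)

    orient : ∀ {x y} → CycleEdge x y → Next x y ⊎ Next y x
    orient (t , s , t→s , inj₁ (wt≡x , ws≡y)) = inj₁ (t , s , t→s , wt≡x , ws≡y)
    orient (t , s , t→s , inj₂ (wt≡y , ws≡x)) = inj₂ (t , s , t→s , wt≡y , ws≡x)

    Next-functional : ∀ {x y y′} → Next x y → Next x y′ → y ≡ y′
    Next-functional (t , s , t→s , refl , refl) (t′ , s′ , t′→s′ , wt′≡wt , refl)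
      with w-inj wt′≡wt
    ... | refl with CycSucc-functional t→s t′→s′
    ... | refl = refl

    Next-injective : ∀ {x x′ y} → Next x y → Next x′ y → x ≡ x′
    Next-injective (t , s , t→s , refl , refl) (t′ , s′ , t′→s′ , refl , ws′≡ws)
      with w-inj ws′≡ws
    ... | refl with CycSucc-injective t→s t′→s′
    ... | refl = refl

  at-most-two-neighbours : ∀ {x y₁ y₂ y₃} → CycleEdge x y₁ → CycleEdge x y₂ → CycleEdge x y₃ →
                           y₁ ≡ y₂ ⊎ y₁ ≡ y₃ ⊎ y₂ ≡ y₃
  at-most-two-neighbours e₁ e₂ e₃ with orient e₁ | orient e₂ | orient e₃
  ... | inj₁ n₁ | inj₁ n₂ | _       = inj₁ (Next-functional n₁ n₂)
  ... | inj₂ p₁ | inj₂ p₂ | _       = inj₁ (Next-injective p₁ p₂)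
  ... | inj₁ n₁ | inj₂ _  | inj₁ n₃ = inj₂ (inj₁ (Next-functional n₁ n₃))
  ... | inj₁ _  | inj₂ p₂ | inj₂ p₃ = inj₂ (inj₂ (Next-injective p₂ p₃))
  ... | inj₂ _  | inj₁ n₂ | inj₁ n₃ = inj₂ (inj₂ (Next-functional n₂ n₃))
  ... | inj₂ p₁ | inj₁ _  | inj₂ p₃ = inj₂ (inj₁ (Next-injective p₁ p₃))

  OnCycle : Fin c × Fin r → Set
  OnCycle (i , j) = EdgeIn C i j

  same-column : ∀ {i j j₁ j₂} → OnCycle (i , j) → OnCycle (i , j₁) → OnCycle (i , j₂) →
                (i , j) ≢ (i , j₁) → (i , j) ≢ (i , j₂) → (i , j₁) ≡ (i , j₂)
  same-column b x y b≢x b≢y with at-most-two-neighbours b x y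
  ... | inj₁ eq        = ⊥-elim (b≢x (cong (_ ,_) (inj₂-injective eq)))
  ... | inj₂ (inj₁ eq) = ⊥-elim (b≢y (cong (_ ,_) (inj₂-injective eq)))
  ... | inj₂ (inj₂ eq) = cong (_ ,_) (inj₂-injective eq)

  same-row : ∀ {i i₁ i₂ j} → OnCycle (i , j) → OnCycle (i₁ , j) → OnCycle (i₂ , j) →
             (i , j) ≢ (i₁ , j) → (i , j) ≢ (i₂ , j) → (i₁ , j) ≡ (i₂ , j)
  same-row b x y b≢x b≢y with at-most-two-neighbours (CycleEdge-sym b) (CycleEdge-sym x) (CycleEdge-sym y)
  ... | inj₁ eq        = ⊥-elim (b≢x (cong (_, _) (inj₁-injective eq)))
  ... | inj₂ (inj₁ eq) = ⊥-elim (b≢y (cong (_, _) (inj₁-injective eq)))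
  ... | inj₂ (inj₂ eq) = cong (_, _) (inj₁-injective eq)

  at-most-two-line-neighbours :
    ∀ {b x y z} → OnCycle b → OnCycle x → OnCycle y → OnCycle z → b ≢ x → b ≢ y → b ≢ z →
    SharesLine b x → SharesLine b y → SharesLine b z → x ≡ y ⊎ x ≡ z ⊎ y ≡ z
  at-most-two-line-neighbours {_ , _} {_ , _} {_ , _} {_ , _} b x y z b≢x b≢y b≢z = λ where
    (inj₁ refl) (inj₁ refl) _           → inj₁ (same-column b x y b≢x b≢y)
    (inj₂ refl) (inj₂ refl) _           → inj₁ (same-row b x y b≢x b≢y)
    (inj₁ refl) (inj₂ _)    (inj₁ refl) → inj₂ (inj₁ (same-column b x z b≢x b≢z))
    (inj₁ _)    (inj₂ refl) (inj₂ refl) → inj₂ (inj₂ (same-row b y z b≢y b≢z))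
    (inj₂ _)    (inj₁ refl) (inj₁ refl) → inj₂ (inj₂ (same-column b y z b≢y b≢z))
    (inj₂ refl) (inj₁ _)    (inj₂ refl) → inj₂ (inj₁ (same-row b x z b≢x b≢z))

module CoilArcs {c r n} (P : PMM c r) (π : GP (PMM.M P) n) (K : Coil P π) where
  open GP π
  open Coil K
  open Orientation P π
  open CycleDegree cyc

  3≤ℓ : 3 ≤ ℓ
  3≤ℓ = Cycle.len≥3 cyc

  instance
    ℓ-nonZero : NonZero ℓ
    ℓ-nonZero = ℕ.>-nonZero (ℕP.<-≤-trans (s≤s z≤n) 3≤ℓ)

  cellAt : ℕ → Fin c × Fin r
  cellAt i = lab (i mod ℓ)

  cellAt-cong : ∀ {i j} → i % ℓ ≡ j % ℓ → cellAt i ≡ cellAt j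
  cellAt-cong i≡j = cong lab (FP.toℕ-injective (begin
    toℕ (_ mod ℓ)  ≡⟨ FP.toℕ-fromℕ< _ ⟩
    _ % ℓ          ≡⟨ i≡j ⟩
    _ % ℓ          ≡⟨ FP.toℕ-fromℕ< _ ⟨
    toℕ (_ mod ℓ)  ∎))
    where open ≡-Reasoning

  cellAt-injective : ∀ {i j} → cellAt i ≡ cellAt j → i % ℓ ≡ j % ℓ
  cellAt-injective i≈j =
    trans (sym (FP.toℕ-fromℕ< _)) (trans (cong toℕ (lab-inj i≈j)) (FP.toℕ-fromℕ< _))

  cellAt-onCycle : ∀ i → OnCycle (cellAt i)
  cellAt-onCycle i = proj₂ (lab-cyc _ _) (i mod ℓ , refl)

  cell-v : ∀ a → cell (v a) ≡ cellAt (toℕ a)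
  cell-v a = C1 a (toℕ a mod ℓ) (toℕ a / ℓ) (begin
    toℕ a                              ≡⟨ m≡m%n+[m/n]*n (toℕ a) ℓ ⟩
    toℕ a % ℓ + toℕ a / ℓ * ℓ          ≡⟨ ℕP.+-comm (toℕ a % ℓ) _ ⟩
    toℕ a / ℓ * ℓ + toℕ a % ℓ          ≡⟨ cong (toℕ a / ℓ * ℓ +_) (FP.toℕ-fromℕ< _) ⟨
    toℕ a / ℓ * ℓ + toℕ (toℕ a mod ℓ)  ∎)
    where open ≡-Reasoning

  cell-v-≡ : ∀ {a b} → toℕ a % ℓ ≡ toℕ b % ℓ → cell (v a) ≡ cell (v b)
  cell-v-≡ {a} {b} a≡b = trans (cell-v a) (trans (cellAt-cong a≡b) (sym (cell-v b)))

  cell-v-≢ : ∀ {a b} → toℕ a % ℓ ≢ toℕ b % ℓ → cell (v a) ≢ cell (v b)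
  cell-v-≢ {a} {b} a≢b a≈b = a≢b (cellAt-injective (trans (sym (cell-v a)) (trans a≈b (cell-v b))))

  consecutive-cells-differ : ∀ {a b} → toℕ b ≡ suc (toℕ a) → cell (v a) ≢ cell (v b)
  consecutive-cells-differ {a} b≡1+a = cell-v-≢
    (subst (λ i → toℕ a % ℓ ≢ i % ℓ) (sym b≡1+a) (proj₁ (neighbour-residues-distinct 3≤ℓ (toℕ a))))

  cellAt-adjacent : ∀ i → SharesLine (cellAt i) (cellAt (suc i))
  cellAt-adjacent i = subst₂ SharesLine
    (trans (cell-v p) (cellAt-cong (trans (cong (_% ℓ) p≡i%ℓ) (m%n%n≡m%n i ℓ))))
    (trans (cell-v q)
      (cellAt-cong (trans (cong (_% ℓ) q≡1+i%ℓ) ([1+m]%n≡[1+o]%n ℓ (m%n%n≡m%n i ℓ)))))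
    (Arc⇒SharesLine (C2 p q (trans q≡1+i%ℓ (cong suc (sym p≡i%ℓ)))))
    where
    p : Fin n
    p = fromℕ< (ℕP.<-trans (m%n<n i ℓ) ℓ<n)
    q : Fin n
    q = fromℕ< (ℕP.≤-<-trans (m%n<n i ℓ) ℓ<n)
    p≡i%ℓ : toℕ p ≡ i % ℓ
    p≡i%ℓ = FP.toℕ-fromℕ< _
    q≡1+i%ℓ : toℕ q ≡ suc (i % ℓ)
    q≡1+i%ℓ = FP.toℕ-fromℕ< _

  -- The cells i - 1, i + 1 and j would be three distinct line-neighbours of cell i on the cycle.
  SharesLine⇒neighbouring-residues : ∀ i j → SharesLine (cellAt i) (cellAt j) →
    i % ℓ ≡ j % ℓ ⊎ suc i % ℓ ≡ j % ℓ ⊎ suc j % ℓ ≡ i % ℓ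
  SharesLine⇒neighbouring-residues i j i∣j
    with i % ℓ ℕ.≟ j % ℓ | neighbour-residues-distinct 3≤ℓ i
  ... | yes i≡j | _ = inj₁ i≡j
  ... | no i≢j | i≢i+1 , i≢i-1 , i+1≢i-1
    with at-most-two-line-neighbours
           (cellAt-onCycle i) (cellAt-onCycle (suc i)) (cellAt-onCycle (i + pred ℓ)) (cellAt-onCycle j)
           (i≢i+1 ∘ cellAt-injective) (i≢i-1 ∘ cellAt-injective) (i≢j ∘ cellAt-injective)
           (cellAt-adjacent i)
           (SharesLine-sym (subst (SharesLine _) (cellAt-cong ([1+m+pred[n]]%n≡m%n i ℓ))
                                                  (cellAt-adjacent (i + pred ℓ))))
           i∣j
  ... | inj₁ i+1≈i-1 = ⊥-elim (i+1≢i-1 (cellAt-injective i+1≈i-1))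
  ... | inj₂ (inj₁ i+1≈j) = inj₂ (inj₁ (cellAt-injective i+1≈j))
  ... | inj₂ (inj₂ i-1≈j) =
    inj₂ (inj₂ (trans ([1+m]%n≡[1+o]%n ℓ (sym (cellAt-injective i-1≈j)))
                      ([1+m+pred[n]]%n≡m%n i ℓ)))

  cell-v-ℓ : ∀ {b d} → toℕ b ≡ toℕ d + ℓ → cell (v b) ≡ cell (v d)
  cell-v-ℓ {b} {d} b≡d+ℓ = cell-v-≡ (trans (cong (_% ℓ) b≡d+ℓ) ([m+n]%n≡m%n (toℕ d) ℓ))

  v≺v-ℓ : ∀ {b d} → toℕ b ≡ toℕ d + ℓ → v b ≺ v d
  v≺v-ℓ {b} {d} b≡d+ℓ with cell-v-ℓ {b} {d} b≡d+ℓ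
  ... | b≈d with toℕ d in d≡ | b≡d+ℓ
  ...   | zero   | b≡ℓ    = Arc⇒≺ b≈d (C4 b d b≡ℓ d≡)
  ...   | suc d′ | b≡d+ℓ′ = Arc-Arc⇒≺
    (C3 b q (trans b≡d+ℓ′ (trans (sym (ℕP.+-suc d′ ℓ)) (cong (_+ suc ℓ) (sym q≡d′)))))
    (C2 q d (trans d≡ (cong suc (sym q≡d′))))
    b≈d
    (λ b≈q → consecutive-cells-differ (trans d≡ (cong suc (sym q≡d′))) (trans (sym b≈q) b≈d))
    where
    q : Fin n
    q = fromℕ< (ℕP.<-trans (ℕP.n<1+n d′) (subst (_< n) d≡ (FP.toℕ<n d)))
    q≡d′ : toℕ q ≡ d′
    q≡d′ = FP.toℕ-fromℕ< _

  ≼-descent : ∀ k {a b} → toℕ b ≡ toℕ a + k * ℓ → v b ≼ v a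
  ≺-descent : ∀ k {a b} → toℕ b ≡ toℕ a + suc k * ℓ → v b ≺ v a

  ≼-descent zero {a} b≡a+0 =
    inj₁ (cong v (FP.toℕ-injective (trans b≡a+0 (ℕP.+-identityʳ (toℕ a)))))
  ≼-descent (suc k) b≡a+ℓ+kℓ = inj₂ (≺-descent k b≡a+ℓ+kℓ)

  ≺-descent k {a} {b} b≡a+ℓ+kℓ = ≺-≼-trans (v≺v-ℓ b≡q+ℓ) (≼-descent k (FP.toℕ-fromℕ< _))
    where
    b≡a+kℓ+ℓ : toℕ b ≡ toℕ a + k * ℓ + ℓ
    b≡a+kℓ+ℓ = begin
      toℕ b                  ≡⟨ b≡a+ℓ+kℓ ⟩
      toℕ a + (ℓ + k * ℓ)    ≡⟨ cong (toℕ a +_) (ℕP.+-comm ℓ (k * ℓ)) ⟩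
      toℕ a + (k * ℓ + ℓ)    ≡⟨ ℕP.+-assoc (toℕ a) (k * ℓ) ℓ ⟨
      toℕ a + k * ℓ + ℓ      ∎
      where open ≡-Reasoning
    q : Fin n
    q = fromℕ< (ℕP.<-trans (ℕP.m<m+n _ (ℕ.>-nonZero⁻¹ ℓ)) (subst (_< n) b≡a+kℓ+ℓ (FP.toℕ<n b)))
    b≡q+ℓ : toℕ b ≡ toℕ q + ℓ
    b≡q+ℓ = trans b≡a+kℓ+ℓ (cong (_+ ℓ) (sym (FP.toℕ-fromℕ< _)))

  reverse-same-residue : ∀ {a b} → toℕ a % ℓ ≡ toℕ b % ℓ → toℕ a < toℕ b → Arc P π (v b) (v a)
  reverse-same-residue {a} {b} a≡b a<b with m%n≡o%n⇒o≡m+k*n ℓ (ℕP.<⇒≤ a<b) a≡b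
  ... | zero , b≡a+0 = ⊥-elim (ℕP.<⇒≢ a<b (sym (trans b≡a+0 (ℕP.+-identityʳ _))))
  ... | suc k , b≡a+ℓ+kℓ = ≺⇒Arc (≺-descent k b≡a+ℓ+kℓ)

  reverse-next-residue : ∀ {a b} → suc (toℕ a) % ℓ ≡ toℕ b % ℓ → suc (toℕ a) < toℕ b →
                         Arc P π (v b) (v a)
  reverse-next-residue {a} {b} a+1≡b a+1<b with m%n≡o%n⇒o≡m+k*n ℓ (ℕP.<⇒≤ a+1<b) a+1≡b
  ... | zero , b≡a+1+0 = ⊥-elim (ℕP.<⇒≢ a+1<b (sym (trans b≡a+1+0 (ℕP.+-identityʳ _))))
  ... | suc k , b≡a+1+ℓ+kℓ = Arc-≼-trans (C3 b q b≡q+1+ℓ) (≼-descent k (FP.toℕ-fromℕ< _))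
    where
    b≡a+kℓ+1+ℓ : toℕ b ≡ toℕ a + k * ℓ + suc ℓ
    b≡a+kℓ+1+ℓ = begin
      toℕ b                       ≡⟨ b≡a+1+ℓ+kℓ ⟩
      suc (toℕ a + (ℓ + k * ℓ))   ≡⟨ cong (λ x → suc (toℕ a + x)) (ℕP.+-comm ℓ (k * ℓ)) ⟩
      suc (toℕ a + (k * ℓ + ℓ))   ≡⟨ cong suc (ℕP.+-assoc (toℕ a) (k * ℓ) ℓ) ⟨
      suc (toℕ a + k * ℓ + ℓ)     ≡⟨ ℕP.+-suc _ ℓ ⟨
      toℕ a + k * ℓ + suc ℓ       ∎
      where open ≡-Reasoning
    q : Fin n
    q = fromℕ< (ℕP.<-trans (ℕP.m<m+n _ (s≤s z≤n)) (subst (_< n) b≡a+kℓ+1+ℓ (FP.toℕ<n b)))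
    b≡q+1+ℓ : toℕ b ≡ toℕ q + suc ℓ
    b≡q+1+ℓ = trans b≡a+kℓ+1+ℓ (cong (_+ suc ℓ) (sym (FP.toℕ-fromℕ< _)))

  -- For a = 0 the role of v_{a-1} → v_a is played by v_{ℓ-1} → v_ℓ ≺ v_0.
  reverse-prev-residue : ∀ {a b} → suc (toℕ b) % ℓ ≡ toℕ a % ℓ → toℕ a < toℕ b →
                         Arc P π (v b) (v a)
  reverse-prev-residue {a} {b} b+1≡a a<b
    with m%n≡o%n⇒o≡m+k*n ℓ (ℕP.<⇒≤ (ℕP.<-trans a<b (ℕP.n<1+n _))) (sym b+1≡a)
  ... | k , b+1≡a+kℓ with toℕ a in a≡
  ... | suc a′ = ≼-Arc-trans (≼-descent k b≡p+kℓ) (C2 p a (trans a≡ (cong suc (sym p≡a′))))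
    where
    p : Fin n
    p = fromℕ< (ℕP.<-trans (ℕP.n<1+n a′) (subst (_< n) a≡ (FP.toℕ<n a)))
    p≡a′ : toℕ p ≡ a′
    p≡a′ = FP.toℕ-fromℕ< _
    b≡p+kℓ : toℕ b ≡ toℕ p + k * ℓ
    b≡p+kℓ = trans (ℕP.suc-injective b+1≡a+kℓ) (cong (_+ k * ℓ) (sym p≡a′))
  ... | zero with k | b+1≡a+kℓ
  ...   | zero   | ()
  ...   | suc k′ | b+1≡ℓ+k′ℓ =
    ≼-Arc-trans (≼-descent k′ b≡p+k′ℓ) (Arc-≼-trans (C2 p f f≡1+p) (inj₂ f≺a))
    where
    p f : Fin n
    p = fromℕ< (ℕP.≤-<-trans ℕP.pred[n]≤n ℓ<n)
    f = fromℕ< ℓ<n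
    f≡ℓ : toℕ f ≡ ℓ
    f≡ℓ = FP.toℕ-fromℕ< _
    1+p≡ℓ : suc (toℕ p) ≡ ℓ
    1+p≡ℓ = trans (cong suc (FP.toℕ-fromℕ< _)) (ℕP.suc-pred ℓ)
    f≡1+p : toℕ f ≡ suc (toℕ p)
    f≡1+p = trans f≡ℓ (sym 1+p≡ℓ)
    f≺a : v f ≺ v a
    f≺a = v≺v-ℓ (trans f≡ℓ (cong (_+ ℓ) (sym a≡)))
    b≡p+k′ℓ : toℕ b ≡ toℕ p + k′ * ℓ
    b≡p+k′ℓ = ℕP.suc-injective (trans b+1≡ℓ+k′ℓ (cong (_+ k′ * ℓ) (sym 1+p≡ℓ)))

  reverse-Arc : ∀ {a b} → Arc P π (v a) (v b) → suc (toℕ a) < toℕ b → Arc P π (v b) (v a)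
  reverse-Arc {a} {b} a→b a+1<b with SharesLine⇒neighbouring-residues (toℕ a) (toℕ b)
                                      (subst₂ SharesLine (cell-v a) (cell-v b) (Arc⇒SharesLine a→b))
  ... | inj₁ a≡b         = reverse-same-residue a≡b (ℕP.<-trans (ℕP.n<1+n _) a+1<b)
  ... | inj₂ (inj₁ a+1≡b) = reverse-next-residue a+1≡b a+1<b
  ... | inj₂ (inj₂ b+1≡a) = reverse-prev-residue b+1≡a (ℕP.<-trans (ℕP.n<1+n _) a+1<b)

  Arc⇒index≤suc : ∀ {a b} → Arc P π (v a) (v b) → toℕ b ≤ suc (toℕ a)
  Arc⇒index≤suc {a} {b} a→b with toℕ b ℕ.≤? suc (toℕ a)
  ... | yes b≤a+1 = b≤a+1
  ... | no b≰a+1 = ⊥-elim (Arc-asym a→b (reverse-Arc a→b (ℕP.≰⇒> b≰a+1)))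

Fin-injective⇒surjective : ∀ {n} (h : Fin n → Fin n) → Injective _≡_ _≡_ h →
                           ∀ y → ∃[ x ] h x ≡ y
Fin-injective⇒surjective {suc n} h h-inj y with FP.any? (λ x → h x FP.≟ y)
... | yes hit = hit
... | no miss = ⊥-elim (FP.<⇒notInjective (ℕP.n<1+n n) h′-inj)
  where
  y≢h : ∀ x → y ≢ h x
  y≢h x y≡hx = miss (x , sym y≡hx)
  h′ : Fin (suc n) → Fin n
  h′ x = F.punchOut (y≢h x)
  h′-inj : Injective _≡_ _≡_ h′
  h′-inj {x} {x′} = h-inj ∘ FP.punchOut-injective (y≢h x) (y≢h x′)

module _ {c r} (P : PMM c r) {m n} {σ : GP (PMM.M P) m} {π : GP (PMM.M P) n} (e : GriddedEmb σ π) where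
  open PMM P
  open GriddedEmb e
  private
    module σ = GP σ
    module π = GP π

  GriddedEmb-injective : Injective _≡_ _≡_ f
  GriddedEmb-injective {x} {y} fx≡fy with FP.<-cmp x y
  ... | tri< x<y _ _ = ⊥-elim (FP.<-irrefl fx≡fy (f-pos x y x<y))
  ... | tri≈ _ x≡y _ = x≡y
  ... | tri> _ _ y<x = ⊥-elim (FP.<-irrefl (sym fx≡fy) (f-pos y x y<x))

  GriddedEmb-cell : ∀ x → Orientation.cell P π (f x) ≡ Orientation.cell P σ x
  GriddedEmb-cell x = cong₂ _,_ (f-col x) (f-row x)

  GriddedEmb-Arc : ∀ {x y} → Arc P σ x y → Arc P π (f x) (f y)
  GriddedEmb-Arc {x} {y} (inj₁ (cx≡cy , x<y)) = inj₁
    ( trans (f-col x) (trans cx≡cy (sym (f-col y)))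
    , subst (λ i → Precedes (cs i) (f x) (f y)) (sym (f-col x))
        (Precedes-mono id f f-pos (cs (σ.col x)) x<y))
  GriddedEmb-Arc {x} {y} (inj₂ (rx≡ry , x<y)) = inj₂
    ( trans (f-row x) (trans rx≡ry (sym (f-row y)))
    , subst (λ j → Precedes (rs j) (π.val (f x)) (π.val (f y))) (sym (f-row x))
        (Precedes-mono σ.val (π.val ∘ f) f-val (rs (σ.row x)) x<y))

endLabel≡○ : ∀ N (a : Fin N) → endLabel N a ≡ ○ → toℕ a ≡ 0 ⊎ suc (toℕ a) ≡ N
endLabel≡○ N a a○ with toℕ a ℕ.≟ 0 | suc (toℕ a) ℕ.≟ N
endLabel≡○ N a a○  | yes a≡0 | _        = inj₁ a≡0
endLabel≡○ N a a○  | no _    | yes a≡N-1 = inj₂ a≡N-1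
endLabel≡○ N a ()  | no _    | no _

endLabel-last : ∀ N (a : Fin N) → suc (toℕ a) ≡ N → endLabel N a ≡ ○
endLabel-last N a a≡N-1 with toℕ a ℕ.≟ 0 | suc (toℕ a) ℕ.≟ N
... | yes _ | _          = refl
... | no _  | yes _      = refl
... | no _  | no a≢N-1   = ⊥-elim (a≢N-1 a≡N-1)

module IndexMap {c r} {P : PMM c r} {m′ n} {σ : GP (PMM.M P) (suc m′)} {π : GP (PMM.M P) n}
                {Kσ : Coil P σ} {Kπ : Coil P π} (L : LabelledEmb P σ Kσ π Kπ) where
  open LabelledEmb L
  open GriddedEmb emb using (f)
  private
    module Kσ = Coil Kσ
    module Kπ = Coil Kπ
    module Aσ = CoilArcs P σ Kσ
    module Aπ = CoilArcs P π Kπ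
    module Oσ = Orientation P σ
    module Oπ = Orientation P π

  g : Fin (suc m′) → Fin n
  g a = proj₁ (Fin-injective⇒surjective Kπ.v Kπ.v-inj (f (Kσ.v a)))

  v∘g≡f∘v : ∀ a → Kπ.v (g a) ≡ f (Kσ.v a)
  v∘g≡f∘v a = proj₂ (Fin-injective⇒surjective Kπ.v Kπ.v-inj (f (Kσ.v a)))

  g-injective : Injective _≡_ _≡_ g
  g-injective {a} {b} ga≡gb = Kσ.v-inj (GriddedEmb-injective P emb (begin
    f (Kσ.v a)   ≡⟨ v∘g≡f∘v a ⟨
    Kπ.v (g a)   ≡⟨ cong Kπ.v ga≡gb ⟩
    Kπ.v (g b)   ≡⟨ v∘g≡f∘v b ⟩
    f (Kσ.v b)   ∎))
    where open ≡-Reasoning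

  g-label : ∀ a → endLabel (suc m′) a ≡ endLabel n (g a)
  g-label a = label a (g a) (sym (v∘g≡f∘v a))

  g-Arc : ∀ {a b} → Arc P σ (Kσ.v a) (Kσ.v b) → Arc P π (Kπ.v (g a)) (Kπ.v (g b))
  g-Arc {a} {b} a→b =
    subst₂ (Arc P π) (sym (v∘g≡f∘v a)) (sym (v∘g≡f∘v b)) (GriddedEmb-Arc P emb a→b)

  g-cell : ∀ {a b} → Oσ.cell (Kσ.v a) ≡ Oσ.cell (Kσ.v b) →
           Oπ.cell (Kπ.v (g a)) ≡ Oπ.cell (Kπ.v (g b))
  g-cell {a} {b} a≈b = begin
    Oπ.cell (Kπ.v (g a))  ≡⟨ cong Oπ.cell (v∘g≡f∘v a) ⟩
    Oπ.cell (f (Kσ.v a))  ≡⟨ GriddedEmb-cell P emb (Kσ.v a) ⟩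
    Oσ.cell (Kσ.v a)      ≡⟨ a≈b ⟩
    Oσ.cell (Kσ.v b)      ≡⟨ GriddedEmb-cell P emb (Kσ.v b) ⟨
    Oπ.cell (f (Kσ.v b))  ≡⟨ cong Oπ.cell (v∘g≡f∘v b) ⟨
    Oπ.cell (Kπ.v (g b))  ∎
    where open ≡-Reasoning

  g-step : ∀ {a b} → toℕ b ≡ suc (toℕ a) → toℕ (g b) ≤ suc (toℕ (g a))
  g-step {a} {b} b≡a+1 = Aπ.Arc⇒index≤suc (g-Arc (Kσ.C2 a b b≡a+1))

  g-bound : ∀ k {a b} → toℕ b ≡ toℕ a + k → toℕ (g b) ≤ toℕ (g a) + k
  g-bound zero {a} b≡a+0 with FP.toℕ-injective {i = a} (sym (trans b≡a+0 (ℕP.+-identityʳ _)))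
  ... | refl = ℕP.m≤m+n _ 0
  g-bound (suc k) {a} {b} b≡a+1+k = begin
    toℕ (g b)            ≤⟨ g-step b≡1+p ⟩
    suc (toℕ (g p))      ≤⟨ s≤s (g-bound k (FP.toℕ-fromℕ< _)) ⟩
    suc (toℕ (g a) + k)  ≡⟨ ℕP.+-suc _ k ⟨
    toℕ (g a) + suc k    ∎
    where
    open ℕP.≤-Reasoning
    b≡1+a+k : toℕ b ≡ suc (toℕ a + k)
    b≡1+a+k = trans b≡a+1+k (ℕP.+-suc _ k)
    p : Fin (suc m′)
    p = fromℕ< (ℕP.<-trans (ℕP.n<1+n _) (subst (_< suc m′) b≡1+a+k (FP.toℕ<n b)))
    b≡1+p : toℕ b ≡ suc (toℕ p)
    b≡1+p = trans b≡1+a+k (cong suc (sym (FP.toℕ-fromℕ< _)))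

  last : Fin (suc m′)
  last = F.fromℕ m′

  g-zero≢first : suc m′ < n → toℕ (g F.zero) ≢ 0
  g-zero≢first m<n g₀≡0 with endLabel≡○ n (g last) (trans (sym (g-label last)) last○)
    where
    last○ : endLabel (suc m′) last ≡ ○
    last○ = endLabel-last (suc m′) last (cong suc (FP.toℕ-fromℕ m′))
  ... | inj₁ gₗ≡0 =
    ℕP.<⇒≱ (subst (Kσ.ℓ <_) (cong suc m′≡0) Kσ.ℓ<n) (ℕP.≤-trans (s≤s z≤n) Aσ.3≤ℓ)
    where
    m′≡0 : m′ ≡ 0
    m′≡0 = trans (sym (FP.toℕ-fromℕ m′))
                 (cong toℕ (g-injective (FP.toℕ-injective (trans gₗ≡0 (sym g₀≡0)))))
  ... | inj₂ gₗ≡n-1 = ℕP.<⇒≱ m<n (subst (_≤ suc m′) gₗ≡n-1 (s≤s gₗ≤m′))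
    where
    gₗ≤m′ : toℕ (g last) ≤ m′
    gₗ≤m′ = subst (λ x → toℕ (g last) ≤ x + m′) g₀≡0 (g-bound m′ (FP.toℕ-fromℕ m′))

  g-zero≢last : suc (toℕ (g F.zero)) ≢ n
  g-zero≢last g₀≡n-1 = Aπ.consecutive-cells-differ g₀≡1+gℓ (g-cell (Aσ.cell-v-ℓ ℓ′≡ℓ))
    where
    ℓ′ : Fin (suc m′)
    ℓ′ = fromℕ< Kσ.ℓ<n
    ℓ′≡ℓ : toℕ ℓ′ ≡ Kσ.ℓ
    ℓ′≡ℓ = FP.toℕ-fromℕ< _
    g₀≤1+gℓ : toℕ (g F.zero) ≤ suc (toℕ (g ℓ′))
    g₀≤1+gℓ = Aπ.Arc⇒index≤suc (g-Arc (Kσ.C4 ℓ′ F.zero ℓ′≡ℓ refl))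
    gℓ≤g₀ : toℕ (g ℓ′) ≤ toℕ (g F.zero)
    gℓ≤g₀ = ℕ.s≤s⁻¹ (subst (toℕ (g ℓ′) <_) (sym g₀≡n-1) (FP.toℕ<n (g ℓ′)))
    gℓ≢g₀ : toℕ (g ℓ′) ≢ toℕ (g F.zero)
    gℓ≢g₀ gℓ≡g₀ = ℕP.<⇒≢ (ℕP.<-≤-trans (s≤s z≤n) Aσ.3≤ℓ)
      (sym (trans (sym ℓ′≡ℓ) (cong toℕ (g-injective (FP.toℕ-injective gℓ≡g₀)))))
    g₀≡1+gℓ : toℕ (g F.zero) ≡ suc (toℕ (g ℓ′))
    g₀≡1+gℓ = ℕP.≤-antisym g₀≤1+gℓ (ℕP.≤∧≢⇒< gℓ≤g₀ gℓ≢g₀)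

lemma4p11 : ∀ {c r} (P : PMM c r) → Unicyclic (PMM.M P) →
              ∀ {m n} (π : GP (PMM.M P) n) (Kπ : Coil P π)
                (σ : GP (PMM.M P) m) (Kσ : Coil P σ) →
              m < n → ¬ LabelledEmb P σ Kσ π Kπ
lemma4p11 P _ {zero} π Kπ σ Kσ _ _ = ℕP.n≮0 (Coil.ℓ<n Kσ)
lemma4p11 P _ {suc m′} {n} π Kπ σ Kσ m<n L =
  [ g-zero≢first m<n , g-zero≢last ]′ (endLabel≡○ n (g F.zero) (sym (g-label F.zero)))
  where open IndexMap L
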